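{- Let $D$ be a positive integer and $p$ a prime with $D>p^2$. Suppose $f$ is a reduced primitive form of discriminant $-4Dp^2$ which is derived from $e_{ -4D}=(1,0,D)\in C(-4D)$, and $f$ is not equivalent to $e_{ -4Dp^2}=(1,0,Dp^2)$. Then \[ f=(p^2,\,2pk,\,k^2+D) \] for some integer $k$ with $-p/2\le k\le p/2$.
   Context: A binary quadratic form $(a,b,c)$ is $ax^2+bxy+cy^2$ with $a,b,c\in\mathbb{Z}$, of discriminant $b^2-4ac$; primitive means $\gcd(a,b,c)=1$; equivalence is via substitutions $(x,y)^T\mapsto A(x,y)^T$, $A\in SL_2(\mathbb{Z})$. A form $(a,b,c)$ of negative discriminant is reduced if $|b|\le a\le c$, and $b\ge 0$ whenever $|b|=a$ or $a=c$; every such form is equivalent to a unique reduced form. $C(\Delta)$ denotes the class group of primitive forms of discriminant $\Delta<0$. For a positive integer $r$, a primitive form $f$ of discriminant $\Delta r^2$ is derived from a form $g$ of discriminant $\Delta$ if $f$ is equivalent to $g(A\cdot(x,y)^T)$ for some $2\times2$ integer matrix $A$ with $\det(A)=r$. -}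

module Defs where

open import Data.Nat using (ℕ)
open import Data.Nat.GCD using (gcd)
open import Data.Integer using (ℤ; +_; _+_; _*_; _-_; -_; ∣_∣; _≤_)
open import Data.Product using (Σ; _×_; _,_; ∃)
open import Data.Sum using (_⊎_)
open import Relation.Binary.PropositionalEquality using (_≡_)

-- A binary quadratic form (a , b , c) stands for a x² + b x y + c y².
record Form : Set where
  constructor form
  field
    a b c : ℤ
open Form public

disc : Form → ℤ
disc (form a b c) = b * b - (+ 4) * (a * c)

Primitive : Form → Set
Primitive (form a b c) = gcd (gcd ∣ a ∣ ∣ b ∣) ∣ c ∣ ≡ 1

record Mat : Set where
  constructor mat
  field
    α β γ δ : ℤ
open Mat public

det : Mat → ℤ
det (mat α β γ δ) = α * δ - β * γ

-- g ∘ A : the form g(αx+βy, γx+δy)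
_·_ : Form → Mat → Form
form a b c · mat α β γ δ =
  form (a * (α * α) + b * (α * γ) + c * (γ * γ))
       ((+ 2) * a * (α * β) + b * (α * δ + β * γ) + (+ 2) * c * (γ * δ))
       (a * (β * β) + b * (β * δ) + c * (δ * δ))

Equiv : Form → Form → Set
Equiv f g = Σ Mat λ M → det M ≡ + 1 × g ≡ f · M

Reduced : Form → Set
Reduced (form a b c) =
  (+ ∣ b ∣ ≤ a) × (a ≤ c) × ((+ ∣ b ∣ ≡ a ⊎ a ≡ c) → + 0 ≤ b)

DerivedFrom : ℕ → Form → Form → Set
DerivedFrom r f g =
  Primitive f × (disc f ≡ disc g * ((+ r) * (+ r))) ×
  (Σ Mat λ A → det A ≡ + r × Equiv f (g · A))

module Submission where

-- Write f = g · N with g = (1, 0, D), N = [[α, β], [γ, δ]] and det N = p (A composed with the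
-- inverse of the equivalence). As f is reduced, its first coefficient α² + Dγ² is its least value
-- at a nonzero vector, hence at most f(δ, −γ) = g(p, 0) = p² < D; so γ = 0 and αδ = p. If |α| = 1,
-- reducedness forces β = 0 and f = (1, 0, Dp²). Otherwise δ = ±1, α = pδ and
-- f = (p², 2p·δβ, (δβ)² + D), where |b| ≤ a gives |2δβ| ≤ p.

open import Defs
open import Data.Nat using (ℕ; _<_)
open import Data.Nat.Primality using (Prime; prime⇒irreducible; prime⇒nonZero)
open import Data.Nat.Divisibility using (divides)
open import Data.Integer using (ℤ; +_; -[1+_]; _+_; _*_; -_; _-_; ∣_∣; _≤_; +≤+; -≤+)
open import Data.Integer.Tactic.RingSolver using (solve-∀)
open import Data.Product using (Σ; _×_; _,_)
open import Data.Sum using (inj₁; inj₂; [_,_]′)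
open import Data.Empty using (⊥-elim)
open import Relation.Nullary using (¬_)
open import Relation.Binary.PropositionalEquality
  using (_≡_; refl; sym; trans; cong; cong₂; subst; subst₂; module ≡-Reasoning)
import Data.Nat as ℕ
import Data.Nat.Properties as ℕ
import Data.Integer.Properties as ℤ

principal : ℕ → Form
principal D = form (+ 1) (+ 0) (+ D)

eval : Form → ℤ → ℤ → ℤ
eval (form a b c) x y = a * (x * x) + b * (x * y) + c * (y * y)

form-cong : ∀ {a b c a′ b′ c′} → a ≡ a′ → b ≡ b′ → c ≡ c′ → form a b c ≡ form a′ b′ c′
form-cong refl refl refl = refl

form-ext : ∀ f g → (∀ x y → eval f x y ≡ eval g x y) → f ≡ g
form-ext (form a b c) (form a′ b′ c′) f≗g = form-cong a≡a′ b≡b′ c≡c′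
  where
  at-e₁ : ∀ a b c → a * (+ 1 * + 1) + b * (+ 1 * + 0) + c * (+ 0 * + 0) ≡ a
  at-e₁ = solve-∀
  at-e₂ : ∀ a b c → a * (+ 0 * + 0) + b * (+ 0 * + 1) + c * (+ 1 * + 1) ≡ c
  at-e₂ = solve-∀
  at-e₁+e₂ : ∀ a b c → b ≡ a * (+ 1 * + 1) + b * (+ 1 * + 1) + c * (+ 1 * + 1)
                           - (a * (+ 1 * + 1) + b * (+ 1 * + 0) + c * (+ 0 * + 0))
                           - (a * (+ 0 * + 0) + b * (+ 0 * + 1) + c * (+ 1 * + 1))
  at-e₁+e₂ = solve-∀
  a≡a′ : a ≡ a′
  a≡a′ = trans (sym (at-e₁ a b c)) (trans (f≗g (+ 1) (+ 0)) (at-e₁ a′ b′ c′))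
  c≡c′ : c ≡ c′
  c≡c′ = trans (sym (at-e₂ a b c)) (trans (f≗g (+ 0) (+ 1)) (at-e₂ a′ b′ c′))
  b≡b′ : b ≡ b′
  b≡b′ = trans (at-e₁+e₂ a b c)
           (trans (cong₂ _-_ (cong₂ _-_ (f≗g (+ 1) (+ 1)) (f≗g (+ 1) (+ 0))) (f≗g (+ 0) (+ 1)))
                  (sym (at-e₁+e₂ a′ b′ c′)))

eval-· : ∀ f M x y → eval (f · M) x y ≡ eval f (α M * x + β M * y) (γ M * x + δ M * y)
eval-· (form a b c) (mat α β γ δ) = expand a b c α β γ δ
  where
  expand : ∀ a b c α β γ δ x y →
    (a * (α * α) + b * (α * γ) + c * (γ * γ)) * (x * x)
    + ((+ 2) * a * (α * β) + b * (α * δ + β * γ) + (+ 2) * c * (γ * δ)) * (x * y)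
    + (a * (β * β) + b * (β * δ) + c * (δ * δ)) * (y * y)
    ≡ a * ((α * x + β * y) * (α * x + β * y)) + b * ((α * x + β * y) * (γ * x + δ * y))
      + c * ((γ * x + δ * y) * (γ * x + δ * y))
  expand = solve-∀

_⊗_ : Mat → Mat → Mat
mat a b c d ⊗ mat e f g h = mat (a * e + b * g) (a * f + b * h) (c * e + d * g) (c * f + d * h)

adj : Mat → Mat
adj (mat a b c d) = mat d (- b) (- c) a

I₂ : Mat
I₂ = mat (+ 1) (+ 0) (+ 0) (+ 1)

mat-cong : ∀ {a b c d a′ b′ c′ d′} → a ≡ a′ → b ≡ b′ → c ≡ c′ → d ≡ d′ →
           mat a b c d ≡ mat a′ b′ c′ d′
mat-cong refl refl refl refl = refl

det-⊗ : ∀ M N → det (M ⊗ N) ≡ det M * det N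
det-⊗ (mat a b c d) (mat e f g h) = expand a b c d e f g h
  where
  expand : ∀ a b c d e f g h →
    (a * e + b * g) * (c * f + d * h) - (a * f + b * h) * (c * e + d * g)
    ≡ (a * d - b * c) * (e * h - f * g)
  expand = solve-∀

⊗-adj : ∀ M → det M ≡ + 1 → M ⊗ adj M ≡ I₂
⊗-adj (mat a b c d) det≡1 = mat-cong (trans (top-left a b c d) det≡1) (top-right a b)
                                     (bottom-left c d) (trans (bottom-right a b c d) det≡1)
  where
  top-left : ∀ a b c d → a * d + b * (- c) ≡ a * d - b * c
  top-left = solve-∀
  top-right : ∀ a b → a * (- b) + b * a ≡ + 0
  top-right = solve-∀
  bottom-left : ∀ c d → c * d + d * (- c) ≡ + 0
  bottom-left = solve-∀
  bottom-right : ∀ a b c d → c * (- b) + d * a ≡ a * d - b * c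
  bottom-right = solve-∀

det-adj : ∀ M → det (adj M) ≡ det M
det-adj (mat a b c d) = swap a b c d
  where
  swap : ∀ a b c d → d * a - (- b) * (- c) ≡ a * d - b * c
  swap = solve-∀

row-⊗ : ∀ a b a′ b′ c′ d′ x y →
        a * (a′ * x + b′ * y) + b * (c′ * x + d′ * y) ≡ (a * a′ + b * c′) * x + (a * b′ + b * d′) * y
row-⊗ = solve-∀

·-⊗ : ∀ f M N → (f · M) · N ≡ f · (M ⊗ N)
·-⊗ f M@(mat a b c d) N@(mat a′ b′ c′ d′) = form-ext _ _ λ x y → begin
  eval ((f · M) · N) x y
    ≡⟨ eval-· (f · M) N x y ⟩
  eval (f · M) (a′ * x + b′ * y) (c′ * x + d′ * y)
    ≡⟨ eval-· f M _ _ ⟩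
  eval f (a * (a′ * x + b′ * y) + b * (c′ * x + d′ * y)) (c * (a′ * x + b′ * y) + d * (c′ * x + d′ * y))
    ≡⟨ cong₂ (eval f) (row-⊗ a b a′ b′ c′ d′ x y) (row-⊗ c d a′ b′ c′ d′ x y) ⟩
  eval f ((a * a′ + b * c′) * x + (a * b′ + b * d′) * y) ((c * a′ + d * c′) * x + (c * b′ + d * d′) * y)
    ≡⟨ eval-· f (M ⊗ N) x y ⟨
  eval (f · (M ⊗ N)) x y ∎
  where open ≡-Reasoning

·-I₂ : ∀ f → f · I₂ ≡ f
·-I₂ f = form-ext _ _ λ x y → trans (eval-· f I₂ x y) (cong₂ (eval f) (unit x y) (sym (unit′ y x)))
  where
  unit : ∀ x y → + 1 * x + + 0 * y ≡ x
  unit = solve-∀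
  unit′ : ∀ y x → y ≡ + 0 * x + + 1 * y
  unit′ = solve-∀

·-adj : ∀ f M → det M ≡ + 1 → (f · M) · adj M ≡ f
·-adj f M det≡1 = trans (·-⊗ f M (adj M)) (trans (cong (f ·_) (⊗-adj M det≡1)) (·-I₂ f))

Equiv-refl : ∀ f → Equiv f f
Equiv-refl f = I₂ , refl , sym (·-I₂ f)

derived⇒transform : ∀ {r f} g → DerivedFrom r f g → Σ Mat λ N → det N ≡ + r × f ≡ g · N
derived⇒transform {r} {f} g (_ , _ , A , det≡r , M , det≡1 , g·A≡f·M) =
  A ⊗ adj M ,
  trans (det-⊗ A (adj M)) (trans (cong₂ _*_ det≡r (trans (det-adj M) det≡1)) (ℤ.*-identityʳ (+ r))) ,
  trans (sym (·-adj f M det≡1)) (trans (cong (_· adj M) (sym g·A≡f·M)) (·-⊗ g A (adj M)))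

1+m*n≤m*m+n*n : ∀ m n → ¬ (m ≡ 0 × n ≡ 0) → 1 ℕ.+ m ℕ.* n ℕ.≤ m ℕ.* m ℕ.+ n ℕ.* n
1+m*n≤m*m+n*n ℕ.zero    ℕ.zero    m,n≢0 = ⊥-elim (m,n≢0 (refl , refl))
1+m*n≤m*m+n*n ℕ.zero    (ℕ.suc n) _     = ℕ.s≤s ℕ.z≤n
1+m*n≤m*m+n*n (ℕ.suc m) ℕ.zero    _     rewrite ℕ.*-zeroʳ m = ℕ.s≤s ℕ.z≤n
1+m*n≤m*m+n*n m@(ℕ.suc _) n@(ℕ.suc _) _ with ℕ.≤-total m n
... | inj₁ m≤n = ℕ.+-mono-≤ (ℕ.s≤s ℕ.z≤n) (ℕ.*-monoˡ-≤ n m≤n)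
... | inj₂ n≤m = subst (1 ℕ.+ m ℕ.* n ℕ.≤_) (ℕ.+-comm (n ℕ.* n) (m ℕ.* m))
                       (ℕ.+-mono-≤ (ℕ.s≤s ℕ.z≤n) (ℕ.*-monoʳ-≤ m n≤m))

a+b*mn≤a*mm+c*nn : ∀ a b c m n → b ℕ.≤ a → a ℕ.≤ c → ¬ (m ≡ 0 × n ≡ 0) →
                   a ℕ.+ b ℕ.* (m ℕ.* n) ℕ.≤ a ℕ.* (m ℕ.* m) ℕ.+ c ℕ.* (n ℕ.* n)
a+b*mn≤a*mm+c*nn a b c m n b≤a a≤c m,n≢0 = begin
  a ℕ.+ b ℕ.* (m ℕ.* n)               ≤⟨ ℕ.+-monoʳ-≤ a (ℕ.*-monoˡ-≤ (m ℕ.* n) b≤a) ⟩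
  a ℕ.+ a ℕ.* (m ℕ.* n)               ≡⟨ ℕ.*-suc a (m ℕ.* n) ⟨
  a ℕ.* (1 ℕ.+ m ℕ.* n)               ≤⟨ ℕ.*-monoʳ-≤ a (1+m*n≤m*m+n*n m n m,n≢0) ⟩
  a ℕ.* (m ℕ.* m ℕ.+ n ℕ.* n)         ≡⟨ ℕ.*-distribˡ-+ a (m ℕ.* m) (n ℕ.* n) ⟩
  a ℕ.* (m ℕ.* m) ℕ.+ a ℕ.* (n ℕ.* n) ≤⟨ ℕ.+-monoʳ-≤ (a ℕ.* (m ℕ.* m)) (ℕ.*-monoˡ-≤ (n ℕ.* n) a≤c) ⟩
  a ℕ.* (m ℕ.* m) ℕ.+ c ℕ.* (n ℕ.* n) ∎
  where open ℕ.≤-Reasoning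

i*i≡∣i∣*∣i∣ : ∀ i → i * i ≡ + (∣ i ∣ ℕ.* ∣ i ∣)
i*i≡∣i∣*∣i∣ (+ n)      = ℤ.+◃n≡+n _
i*i≡∣i∣*∣i∣ -[1+ n ]   = ℤ.+◃n≡+n _

-∣i∣≤i : ∀ i → - (+ ∣ i ∣) ≤ i
-∣i∣≤i (+ n)      = ℤ.neg-≤-pos
-∣i∣≤i -[1+ n ]   = ℤ.≤-refl

reduced⇒a≤eval : ∀ {f} → Reduced f → ∀ x y → ¬ (x ≡ + 0 × y ≡ + 0) → a f ≤ eval f x y
reduced⇒a≤eval {form (+ A) b (+ C)} (+≤+ ∣b∣≤A , +≤+ A≤C , _) x y x,y≢0 = begin
  + A                                         ≡⟨ add-sub (+ A) (+ R) ⟩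
  (+ A + + R) - + R                           ≤⟨ ℤ.+-mono-≤ A+R≤P+Q -R≤bxy ⟩
  (+ P + + Q) + b * (x * y)                   ≡⟨ cong₂ (λ u v → (u + v) + b * (x * y)) P≡Axx Q≡Cyy ⟩
  (+ A * (x * x) + + C * (y * y)) + b * (x * y) ≡⟨ swap-last (+ A * (x * x)) _ _ ⟩
  + A * (x * x) + b * (x * y) + + C * (y * y) ∎
  where
  open ℤ.≤-Reasoning
  R = ∣ b ∣ ℕ.* (∣ x ∣ ℕ.* ∣ y ∣)
  P = A ℕ.* (∣ x ∣ ℕ.* ∣ x ∣)
  Q = C ℕ.* (∣ y ∣ ℕ.* ∣ y ∣)
  ∣x∣,∣y∣≢0 : ¬ (∣ x ∣ ≡ 0 × ∣ y ∣ ≡ 0)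
  ∣x∣,∣y∣≢0 (∣x∣≡0 , ∣y∣≡0) = x,y≢0 (ℤ.∣i∣≡0⇒i≡0 ∣x∣≡0 , ℤ.∣i∣≡0⇒i≡0 ∣y∣≡0)
  A+R≤P+Q : + A + + R ≤ + P + + Q
  A+R≤P+Q = subst₂ _≤_ (ℤ.pos-+ A R) (ℤ.pos-+ P Q) (+≤+ (a+b*mn≤a*mm+c*nn A _ C _ _ ∣b∣≤A A≤C ∣x∣,∣y∣≢0))
  -R≤bxy : - + R ≤ b * (x * y)
  -R≤bxy = subst (λ t → - + t ≤ b * (x * y)) (trans (ℤ.abs-* b (x * y)) (cong (∣ b ∣ ℕ.*_) (ℤ.abs-* x y)))
                 (-∣i∣≤i (b * (x * y)))
  P≡Axx : + P ≡ + A * (x * x)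
  P≡Axx = trans (ℤ.pos-* A _) (cong (+ A *_) (sym (i*i≡∣i∣*∣i∣ x)))
  Q≡Cyy : + Q ≡ + C * (y * y)
  Q≡Cyy = trans (ℤ.pos-* C _) (cong (+ C *_) (sym (i*i≡∣i∣*∣i∣ y)))
  add-sub : ∀ u v → u ≡ (u + v) - v
  add-sub = solve-∀
  swap-last : ∀ u v w → (u + v) + w ≡ u + w + v
  swap-last = solve-∀
reduced⇒a≤eval {form -[1+ _ ] _ _} (() , _)
reduced⇒a≤eval {form (+ _) _ -[1+ _ ]} (_ , () , _)

-- N maps (δ, −γ) to (det N, 0).
eval-adjugate-column : ∀ f M → eval (f · M) (δ M) (- γ M) ≡ a f * (det M * det M)
eval-adjugate-column (form a b c) (mat α β γ δ) =
  trans (eval-· (form a b c) (mat α β γ δ) δ (- γ))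
        (trans (cong₂ (eval (form a b c)) (first α β γ δ) (second γ δ)) (on-axis a b c (α * δ - β * γ)))
  where
  first : ∀ α β γ δ → α * δ + β * (- γ) ≡ α * δ - β * γ
  first = solve-∀
  second : ∀ γ δ → γ * δ + δ * (- γ) ≡ + 0
  second = solve-∀
  on-axis : ∀ a b c x → a * (x * x) + b * (x * + 0) + c * (+ 0 * + 0) ≡ a * (x * x)
  on-axis = solve-∀

a-principal-· : ∀ D α β γ δ → a (principal D · mat α β γ δ) ≡ α * α + + D * (γ * γ)
a-principal-· D α β γ δ = expand (+ D) α γ
  where
  expand : ∀ d α γ → + 1 * (α * α) + + 0 * (α * γ) + d * (γ * γ) ≡ α * α + d * (γ * γ)
  expand = solve-∀

m+d*nn≤k<d⇒n≡0 : ∀ m d n k → m ℕ.+ d ℕ.* (n ℕ.* n) ℕ.≤ k → k < d → n ≡ 0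
m+d*nn≤k<d⇒n≡0 m d ℕ.zero        k _  _   = refl
m+d*nn≤k<d⇒n≡0 m d n@(ℕ.suc _) k ≤k k<d = ⊥-elim (ℕ.<⇒≱ k<d (begin
  d                          ≤⟨ ℕ.m≤m*n d (n ℕ.* n) ⟩
  d ℕ.* (n ℕ.* n)            ≤⟨ ℕ.m≤n+m _ m ⟩
  m ℕ.+ d ℕ.* (n ℕ.* n)      ≤⟨ ≤k ⟩
  k                          ∎))
  where open ℕ.≤-Reasoning

reduced⇒lower-left≡0 : ∀ D r .{{_ : ℕ.NonZero r}} → r ℕ.* r < D → ∀ N → det N ≡ + r →
                       Reduced (principal D · N) → γ N ≡ + 0
reduced⇒lower-left≡0 D r r*r<D N@(mat α β γ δ) det≡r reduced =
  ℤ.∣i∣≡0⇒i≡0 (m+d*nn≤k<d⇒n≡0 _ D _ _ (ℤ.drop‿+≤+ (subst₂ _≤_ a≡ (sym (ℤ.pos-* r r)) a≤r*r)) r*r<D)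
  where
  column≢0 : ¬ (δ ≡ + 0 × - γ ≡ + 0)
  column≢0 (refl , -γ≡0) with ℤ.neg-injective {j = + 0} -γ≡0
  ... | refl = ℕ.≢-nonZero⁻¹ r (ℤ.+-injective (trans (sym det≡r) (vanishes α β)))
    where
    vanishes : ∀ α β → α * + 0 - β * + 0 ≡ + 0
    vanishes = solve-∀
  a≤r*r : a (principal D · N) ≤ + r * + r
  a≤r*r = begin
    a (principal D · N)              ≤⟨ reduced⇒a≤eval reduced δ (- γ) column≢0 ⟩
    eval (principal D · N) δ (- γ)   ≡⟨ eval-adjugate-column (principal D) N ⟩
    + 1 * (det N * det N)            ≡⟨ ℤ.*-identityˡ _ ⟩
    det N * det N                    ≡⟨ cong₂ _*_ det≡r det≡r ⟩
    + r * + r                        ∎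
    where open ℤ.≤-Reasoning
  a≡ : a (principal D · N) ≡ + (∣ α ∣ ℕ.* ∣ α ∣ ℕ.+ D ℕ.* (∣ γ ∣ ℕ.* ∣ γ ∣))
  a≡ = begin
    a (principal D · N)                          ≡⟨ a-principal-· D α β γ δ ⟩
    α * α + + D * (γ * γ)                        ≡⟨ cong₂ (λ u v → u + + D * v) (i*i≡∣i∣*∣i∣ α) (i*i≡∣i∣*∣i∣ γ) ⟩
    + (∣ α ∣ ℕ.* ∣ α ∣) + + D * + (∣ γ ∣ ℕ.* ∣ γ ∣) ≡⟨ cong (_+_ (+ (∣ α ∣ ℕ.* ∣ α ∣))) (ℤ.pos-* D _) ⟨
    + (∣ α ∣ ℕ.* ∣ α ∣) + + (D ℕ.* (∣ γ ∣ ℕ.* ∣ γ ∣)) ≡⟨ ℤ.pos-+ (∣ α ∣ ℕ.* ∣ α ∣) _ ⟨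
    + (∣ α ∣ ℕ.* ∣ α ∣ ℕ.+ D ℕ.* (∣ γ ∣ ℕ.* ∣ γ ∣)) ∎
    where open ≡-Reasoning

principal-·-upper : ∀ D α β δ →
  principal D · mat α β (+ 0) δ ≡ form (α * α) ((+ 2) * (α * β)) (β * β + + D * (δ * δ))
principal-·-upper D α β δ = form-cong (first α (+ D)) (middle α β δ (+ D)) (last β δ (+ D))
  where
  first : ∀ α d → + 1 * (α * α) + + 0 * (α * + 0) + d * (+ 0 * + 0) ≡ α * α
  first = solve-∀
  middle : ∀ α β δ d →
    (+ 2) * + 1 * (α * β) + + 0 * (α * δ + β * + 0) + (+ 2) * d * (+ 0 * δ) ≡ (+ 2) * (α * β)
  middle = solve-∀
  last : ∀ β δ d → + 1 * (β * β) + + 0 * (β * δ) + d * (δ * δ) ≡ β * β + d * (δ * δ)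
  last = solve-∀

2*n≤1⇒n≡0 : ∀ n → 2 ℕ.* n ℕ.≤ 1 → n ≡ 0
2*n≤1⇒n≡0 ℕ.zero    _          = refl
2*n≤1⇒n≡0 (ℕ.suc n) (ℕ.s≤s le) with ℕ.m+n≤o⇒n≤o n le
... | ()

reduced[1,2m,c]⇒m≡0 : ∀ {m c} → Reduced (form (+ 1) ((+ 2) * m) c) → m ≡ + 0
reduced[1,2m,c]⇒m≡0 {m} (∣2m∣≤1 , _) =
  ℤ.∣i∣≡0⇒i≡0 (2*n≤1⇒n≡0 _ (subst (ℕ._≤ 1) (ℤ.abs-* (+ 2) m) (ℤ.drop‿+≤+ ∣2m∣≤1)))

principal-·-upper-∣α∣≡1 : ∀ D r α β δ → ∣ α ∣ ≡ 1 → ∣ δ ∣ ≡ r →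
  Reduced (principal D · mat α β (+ 0) δ) →
  principal D · mat α β (+ 0) δ ≡ form (+ 1) (+ 0) (+ (D ℕ.* (r ℕ.* r)))
principal-·-upper-∣α∣≡1 D r α β δ ∣α∣≡1 ∣δ∣≡r reduced =
  trans (principal-·-upper D α β δ) (form-cong α*α≡1 (cong ((+ 2) *_) αβ≡0) c≡)
  where
  α*α≡1 : α * α ≡ + 1
  α*α≡1 = trans (i*i≡∣i∣*∣i∣ α) (cong (λ n → + (n ℕ.* n)) ∣α∣≡1)
  αβ≡0 : α * β ≡ + 0
  αβ≡0 = reduced[1,2m,c]⇒m≡0 (subst Reduced (trans (principal-·-upper D α β δ) (form-cong α*α≡1 refl refl)) reduced)
  β≡0 : β ≡ + 0
  β≡0 = ℤ.∣i∣≡0⇒i≡0 (begin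
    ∣ β ∣             ≡⟨ ℕ.*-identityˡ ∣ β ∣ ⟨
    1 ℕ.* ∣ β ∣       ≡⟨ cong (ℕ._* ∣ β ∣) ∣α∣≡1 ⟨
    ∣ α ∣ ℕ.* ∣ β ∣   ≡⟨ ℤ.abs-* α β ⟨
    ∣ α * β ∣         ≡⟨ cong ∣_∣ αβ≡0 ⟩
    0                 ∎)
    where open ≡-Reasoning
  c≡ : β * β + + D * (δ * δ) ≡ + (D ℕ.* (r ℕ.* r))
  c≡ = begin
    β * β + + D * (δ * δ)           ≡⟨ cong (λ u → u * u + + D * (δ * δ)) β≡0 ⟩
    + 0 + + D * (δ * δ)             ≡⟨ ℤ.+-identityˡ _ ⟩
    + D * (δ * δ)                   ≡⟨ cong (+ D *_) (i*i≡∣i∣*∣i∣ δ) ⟩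
    + D * + (∣ δ ∣ ℕ.* ∣ δ ∣)       ≡⟨ cong (λ n → + D * + (n ℕ.* n)) ∣δ∣≡r ⟩
    + D * + (r ℕ.* r)               ≡⟨ ℤ.pos-* D (r ℕ.* r) ⟨
    + (D ℕ.* (r ℕ.* r))             ∎
    where open ≡-Reasoning

principal-·-upper-∣δ∣≡1 : ∀ D r α β δ → α * δ ≡ + r → ∣ δ ∣ ≡ 1 →
  principal D · mat α β (+ 0) δ ≡ form (+ r * + r) ((+ 2) * + r * (δ * β)) ((δ * β) * (δ * β) + + D)
principal-·-upper-∣δ∣≡1 D r α β δ αδ≡r ∣δ∣≡1 = trans (principal-·-upper D α β δ) (form-cong a≡ b≡ c≡)
  where
  δ²≡1 : δ * δ ≡ + 1
  δ²≡1 = trans (i*i≡∣i∣*∣i∣ δ) (cong (λ n → + (n ℕ.* n)) ∣δ∣≡1)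
  *δ² : ∀ x → x * (δ * δ) ≡ x
  *δ² x = trans (cong (x *_) δ²≡1) (ℤ.*-identityʳ x)
  α≡rδ : α ≡ + r * δ
  α≡rδ = begin
    α               ≡⟨ *δ² α ⟨
    α * (δ * δ)     ≡⟨ ℤ.*-assoc α δ δ ⟨
    α * δ * δ       ≡⟨ cong (_* δ) αδ≡r ⟩
    + r * δ         ∎
    where open ≡-Reasoning
  a≡ : α * α ≡ + r * + r
  a≡ = begin
    α * α                   ≡⟨ cong (λ u → u * u) α≡rδ ⟩
    (+ r * δ) * (+ r * δ)   ≡⟨ regroup (+ r) δ ⟩
    (+ r * + r) * (δ * δ)   ≡⟨ *δ² (+ r * + r) ⟩
    + r * + r               ∎
    where
    open ≡-Reasoning
    regroup : ∀ r δ → (r * δ) * (r * δ) ≡ (r * r) * (δ * δ)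
    regroup = solve-∀
  b≡ : (+ 2) * (α * β) ≡ (+ 2) * + r * (δ * β)
  b≡ = trans (cong (λ u → (+ 2) * (u * β)) α≡rδ) (regroup (+ r) δ β)
    where
    regroup : ∀ r δ β → (+ 2) * ((r * δ) * β) ≡ (+ 2) * r * (δ * β)
    regroup = solve-∀
  c≡ : β * β + + D * (δ * δ) ≡ (δ * β) * (δ * β) + + D
  c≡ = begin
    β * β + + D * (δ * δ)         ≡⟨ cong₂ _+_ (sym (*δ² (β * β))) (*δ² (+ D)) ⟩
    β * β * (δ * δ) + + D         ≡⟨ cong (_+ + D) (swap β δ) ⟩
    (δ * β) * (δ * β) + + D       ∎
    where
    open ≡-Reasoning
    swap : ∀ β δ → β * β * (δ * δ) ≡ (δ * β) * (δ * β)
    swap = solve-∀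

∣i∣≤n⇒-n≤i≤n : ∀ i n → ∣ i ∣ ℕ.≤ n → - (+ n) ≤ i × i ≤ + n
∣i∣≤n⇒-n≤i≤n (+ m)    n m≤n   = ℤ.neg-≤-pos , +≤+ m≤n
∣i∣≤n⇒-n≤i≤n -[1+ m ] n 1+m≤n = ℤ.neg-mono-≤ (+≤+ 1+m≤n) , -≤+

reduced⇒middle-bound : ∀ r .{{_ : ℕ.NonZero r}} k c → Reduced (form (+ r * + r) ((+ 2) * + r * k) c) →
                       - (+ r) ≤ (+ 2) * k × (+ 2) * k ≤ + r
reduced⇒middle-bound r k c (∣b∣≤a , _) =
  ∣i∣≤n⇒-n≤i≤n ((+ 2) * k) r (ℕ.*-cancelˡ-≤ r (ℤ.drop‿+≤+ (subst₂ _≤_ ∣b∣≡ (sym (ℤ.pos-* r r)) ∣b∣≤a)))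
  where
  ∣b∣≡ : + ∣ (+ 2) * + r * k ∣ ≡ + (r ℕ.* ∣ (+ 2) * k ∣)
  ∣b∣≡ = cong +_ (trans (cong ∣_∣ (reorder (+ r) k)) (ℤ.abs-* (+ r) ((+ 2) * k)))
    where
    reorder : ∀ r k → (+ 2) * r * k ≡ r * ((+ 2) * k)
    reorder = solve-∀

IsP²Form : ℕ → ℕ → Form → Set
IsP²Form D p f = Σ ℤ λ k → (- (+ p) ≤ (+ 2) * k) × ((+ 2) * k ≤ + p) ×
  (f ≡ form ((+ p) * (+ p)) ((+ 2) * (+ p) * k) (k * k + + D))

upper-triangular-case : ∀ D p → Prime p → ∀ N → γ N ≡ + 0 → det N ≡ + p → Reduced (principal D · N) →
  ¬ principal D · N ≡ form (+ 1) (+ 0) (+ (D ℕ.* (p ℕ.* p))) → IsP²Form D p (principal D · N)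
upper-triangular-case D p p-prime (mat α β _ δ) refl det≡p reduced ≢e =
  [ ∣δ∣≡1-case , ∣δ∣≡p-case ]′ (prime⇒irreducible p-prime (divides ∣ α ∣ (sym ∣α∣*∣δ∣≡p)))
  where
  instance _ = prime⇒nonZero p-prime
  αδ≡p : α * δ ≡ + p
  αδ≡p = trans (sym (drop-zero α β δ)) det≡p
    where
    drop-zero : ∀ α β δ → α * δ - β * + 0 ≡ α * δ
    drop-zero = solve-∀
  ∣α∣*∣δ∣≡p : ∣ α ∣ ℕ.* ∣ δ ∣ ≡ p
  ∣α∣*∣δ∣≡p = trans (sym (ℤ.abs-* α δ)) (cong ∣_∣ αδ≡p)
  ∣δ∣≡1-case : ∣ δ ∣ ≡ 1 → IsP²Form D p (principal D · mat α β (+ 0) δ)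
  ∣δ∣≡1-case ∣δ∣≡1 with reduced⇒middle-bound p (δ * β) _
                          (subst Reduced (principal-·-upper-∣δ∣≡1 D p α β δ αδ≡p ∣δ∣≡1) reduced)
  ... | -p≤2k , 2k≤p = δ * β , -p≤2k , 2k≤p , principal-·-upper-∣δ∣≡1 D p α β δ αδ≡p ∣δ∣≡1
  ∣δ∣≡p-case : ∣ δ ∣ ≡ p → IsP²Form D p (principal D · mat α β (+ 0) δ)
  ∣δ∣≡p-case ∣δ∣≡p = ⊥-elim (≢e (principal-·-upper-∣α∣≡1 D p α β δ ∣α∣≡1 ∣δ∣≡p reduced))
    where
    ∣α∣≡1 : ∣ α ∣ ≡ 1
    ∣α∣≡1 = ℕ.*-cancelʳ-≡ ∣ α ∣ 1 p
              (trans (cong (∣ α ∣ ℕ.*_) (sym ∣δ∣≡p)) (trans ∣α∣*∣δ∣≡p (sym (ℕ.*-identityˡ p))))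

proposition3p1 : (D p : ℕ) → 0 < D → Prime p → p Data.Nat.* p < D →
    (f : Form) → Reduced f → Primitive f →
    disc f ≡ - ((+ 4) * (+ D) * ((+ p) * (+ p))) →
    DerivedFrom p f (form (+ 1) (+ 0) (+ D)) →
    ¬ Equiv f (form (+ 1) (+ 0) (+ (D Data.Nat.* (p Data.Nat.* p)))) →
    Σ ℤ λ k → (- (+ p) ≤ (+ 2) * k) × ((+ 2) * k ≤ + p) ×
      (f ≡ form ((+ p) * (+ p)) ((+ 2) * (+ p) * k) (k * k + + D))
proposition3p1 D p _ p-prime p*p<D f reduced _ _ derived f≁e =
  from-transform (derived⇒transform (principal D) derived)
  where
  from-transform : (Σ Mat λ N → det N ≡ + p × f ≡ principal D · N) → IsP²Form D p f
  from-transform (N , det≡p , f≡gN) =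
    subst (IsP²Form D p) (sym f≡gN) (upper-triangular-case D p p-prime N γ≡0 det≡p reduced′ gN≢e)
    where
    reduced′ : Reduced (principal D · N)
    reduced′ = subst Reduced f≡gN reduced
    γ≡0 : γ N ≡ + 0
    γ≡0 = reduced⇒lower-left≡0 D p ⦃ prime⇒nonZero p-prime ⦄ p*p<D N det≡p reduced′
    gN≢e : ¬ principal D · N ≡ form (+ 1) (+ 0) (+ (D ℕ.* (p ℕ.* p)))
    gN≢e gN≡e = f≁e (subst (Equiv f) (trans f≡gN gN≡e) (Equiv-refl f))
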